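{- Let $n\ge 0$, $k\in\mathbb{Z}$ and $a\in\mathbb{C}$ with $a\neq0$. Then \[ PC_{n}^{(k)}(x:a)=\sum_{l=0}^{n}\left\{\sum_{r=0}^{n-l}\frac{(-1)^{l}}{a^{n-r}}\binom{n}{r}S_{1}(n-r,l)\,PC_{r}^{(k)}(0:a)\right\}x^{l}. \]
   Context: For an integer $k$, $\mathrm{Lif}_k(t)=\sum_{n=0}^{\infty}\frac{t^{n}}{n!\,(n+1)^{k}}$. For $a\neq0$, $PC_n^{(k)}(x:a)$ is defined by $e^{ -t}\,\mathrm{Lif}_k\!\left(\log\left(1+\frac{t}{a}\right)\right)\left(1+\frac{t}{a}\right)^{ -x}=\sum_{n\ge0}PC_n^{(k)}(x:a)\frac{t^n}{n!}$; $PC_r^{(k)}(0:a)$ is its value at $x=0$. $S_1(n,l)$ denotes the (signed) Stirling numbers of the first kind, defined by $x(x-1)\cdots(x-n+1)=\sum_{l=0}^{n}S_1(n,l)x^l$. -}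

module Defs where

open import Level using (Level; _⊔_) renaming (suc to lsuc)
open import Algebra.Bundles using (CommutativeRing)
open import Data.Nat using (ℕ; zero; suc; _∸_)
open import Data.Nat.Combinatorics using (_C_)
open import Data.Integer using (ℤ; +_; -[1+_])
import Data.Integer as ℤ
open import Relation.Nullary using (¬_)

ιR : {c ℓ : Level} (R : CommutativeRing c ℓ) → ℕ → CommutativeRing.Carrier R
ιR R zero = CommutativeRing.0# R
ιR R (suc n) = CommutativeRing._+_ R (CommutativeRing.1# R) (ιR R n)

-- A field of characteristic zero (the paper works over ℂ; the identity is
-- purely algebraic, so we state it over an arbitrary field of char. 0).
record CharZeroField (c ℓ : Level) : Set (lsuc (c ⊔ ℓ)) where
  field
    ring    : CommutativeRing c ℓ
    inv     : (x : CommutativeRing.Carrier ring) →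
              ¬ (CommutativeRing._≈_ ring x (CommutativeRing.0# ring)) →
              CommutativeRing.Carrier ring
    inv-law : (x : CommutativeRing.Carrier ring)
              (p : ¬ (CommutativeRing._≈_ ring x (CommutativeRing.0# ring))) →
              CommutativeRing._≈_ ring (CommutativeRing._*_ ring x (inv x p))
                                       (CommutativeRing.1# ring)
    char0   : (n : ℕ) →
              ¬ (CommutativeRing._≈_ ring (ιR ring (suc n)) (CommutativeRing.0# ring))
  open CommutativeRing ring public hiding (ring)
  ι : ℕ → Carrier
  ι = ιR ring

-- Signed Stirling numbers of the first kind:
-- x(x-1)...(x-n+1) = Σ_l S₁(n,l) x^l
S₁ : ℕ → ℕ → ℤ
S₁ zero zero = + 1
S₁ zero (suc l) = + 0
S₁ (suc n) zero = + 0
S₁ (suc n) (suc l) = S₁ n l ℤ.- (+ n) ℤ.* S₁ n (suc l)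

module FieldOps {c ℓ : Level} (F : CharZeroField c ℓ) where
  open CharZeroField F

  infixr 8 _^_
  _^_ : Carrier → ℕ → Carrier
  x ^ zero = 1#
  x ^ suc n = x * (x ^ n)

  Σ≤ : ℕ → (ℕ → Carrier) → Carrier
  Σ≤ zero f = f 0
  Σ≤ (suc n) f = Σ≤ n f + f (suc n)

  ιℤ : ℤ → Carrier
  ιℤ (+ n) = ι n
  ιℤ -[1+ n ] = - ι (suc n)

  fact : ℕ → Carrier
  fact zero = 1#
  fact (suc n) = ι (suc n) * fact n

  invSuc : ℕ → Carrier
  invSuc m = inv (ι (suc m)) (char0 m)

  invFact : ℕ → Carrier
  invFact zero = 1#
  invFact (suc n) = invSuc n * invFact n

  -- 1 / (m+1)^k  for k ∈ ℤ
  invSucPowℤ : ℕ → ℤ → Carrier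
  invSucPowℤ m (+ k) = invSuc m ^ k
  invSucPowℤ m -[1+ j ] = ι (suc m) ^ suc j

  -- Formal power series: coefficient sequences ℕ → F.
  Series : Set c
  Series = ℕ → Carrier

  _⊛_ : Series → Series → Series
  (f ⊛ g) n = Σ≤ n (λ i → f i * g (n ∸ i))

  pow : Series → ℕ → Series
  pow f zero zero = 1#
  pow f zero (suc n) = 0#
  pow f (suc m) = f ⊛ pow f m

  -- Composition φ(g(t)) = Σ_m φ_m g(t)^m, for g with zero constant term
  -- (so only m ≤ n contribute to the coefficient of t^n).
  compose : Series → Series → Series
  compose φ g n = Σ≤ n (λ m → φ m * pow g m n)

  Lif : ℤ → Series
  Lif k m = invFact m * invSucPowℤ m k

  expS : Carrier → Series
  expS s m = (s ^ m) * invFact m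

  scale : Carrier → Series → Series
  scale s f n = s * f n

  module WithA (a : Carrier) (a≢0 : ¬ (a ≈ 0#)) where
    a⁻¹ : Carrier
    a⁻¹ = inv a a≢0

    -- log(1 + t/a) = Σ_{n≥1} (-1)^{n-1} t^n / (n a^n)
    logA : Series
    logA zero = 0#
    logA (suc n) = ((- 1#) ^ n) * invSuc n * (a⁻¹ ^ suc n)

    -- (1 + t/a)^{-x} := exp(-x log(1 + t/a))
    powA : Carrier → Series
    powA x = compose (expS 1#) (scale (- x) logA)

    genPC : ℤ → Carrier → Series
    genPC k x = (expS (- 1#) ⊛ compose (Lif k) logA) ⊛ powA x

    PC : ℤ → ℕ → Carrier → Carrier
    PC k n x = fact n * genPC k x n

module Submission where

-- The generating series of PC^{(k)}(x:a) is H ⊛ (1 + t/a)^{-x}, where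
-- H = e^{-t} Lif_k(log(1 + t/a)) does not depend on x.  Hence
--   PC_n(x) = n! Σ_r H_r [t^{n-r}] (1 + t/a)^{-x}   and   PC_r(0) = r! H_r,
-- and everything reduces to the coefficients of (1 + t/a)^{-x} =
-- Σ_m (-x)^m L^m / m!, with L = log(1 + t/a), via the classical
--   (★)  [t^n] L^m = m! S₁(n,m) / (a^n n!).
-- For (★) we use the derivation θ = (a + t) d/dt: θL = 1, so by Leibniz
-- θ(L^{m+1}) = (m+1) L^m, a recurrence on coefficients that the right side of
-- (★) shares by the Stirling recurrence.

open import Defs
open import Level using (Level)
open import Algebra.Bundles using (CommutativeRing)
open import Data.Empty using (⊥-elim)
open import Data.Nat as ℕ using (ℕ; zero; suc; _∸_; _≤_; _<_; z≤n; s≤s; _!)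
import Data.Nat.Properties as ℕP
open import Data.Nat.Combinatorics using (_C_; nCk≡n!/k![n-k]!; k![n∸k]!∣n!)
open import Data.Nat.DivMod using (m/n*n≡m)
open import Data.Integer as ℤ using (ℤ; +_; -[1+_])
import Data.Integer.Properties as ℤP
open import Data.Sign as Sign using (Sign)
open import Data.Sum using (inj₁; inj₂)
import Data.Maybe as Maybe
open import Relation.Nullary using (¬_)
open import Relation.Binary.PropositionalEquality as P using (_≡_)
open import Relation.Binary.Consequences using (dec⇒weaklyDec)
open import Algebra.Solver.Ring.AlmostCommutativeRing
  using (fromCommutativeRing; _-Raw-AlmostCommutative⟶_)
import Algebra.Solver.Ring as RingSolver
import Algebra.Properties.Ring as RingProperties
import Algebra.Properties.Semiring.Mult as SemiringMult
import Algebra.Properties.CommutativeSemigroup as CommSemigroupProperties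

choose-factorials : ∀ {n r} → r ≤ n → (n C r) ℕ.* (r ! ℕ.* (n ∸ r) !) ≡ n !
choose-factorials {n} {r} r≤n =
  P.trans (P.cong (ℕ._* (r ! ℕ.* (n ∸ r) !)) (nCk≡n!/k![n-k]! r≤n))
          (m/n*n≡m (k![n∸k]!∣n! r≤n))
  where instance _ = ℕP._!*_!≢0 r (n ∸ r)

-- Index bookkeeping for exchanging the ranges l ≤ n ∸ r and r ≤ n ∸ l.
∸-swap-< : ∀ n l r → r ≤ n → n ∸ l < r → n ∸ r < l
∸-swap-< n zero r r≤n n<r = ⊥-elim (ℕP.<⇒≱ n<r r≤n)
∸-swap-< n l@(suc _) r _ n∸l<r = ℕP.m<n+o⇒m∸n<o n r (begin-strict
  n              ≤⟨ ℕP.m≤n+m∸n n l ⟩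
  l ℕ.+ (n ∸ l)  <⟨ ℕP.+-monoʳ-< l n∸l<r ⟩
  l ℕ.+ r        ≡⟨ ℕP.+-comm l r ⟩
  r ℕ.+ l        ∎)
  where open ℕP.≤-Reasoning

module _ {c ℓ : Level} (F : CharZeroField c ℓ) where
  open CharZeroField F hiding (zero)
  open FieldOps F
  open RingProperties (CommutativeRing.ring ring)
    using (-1*x≈-x; -‿involutive; -‿+-comm; -‿distribʳ-*; -0#≈0#; +-cancelʳ)
  open SemiringMult semiring using (_×_; ×-homo-+; ×1-homo-*)
  open CommSemigroupProperties +-commutativeSemigroup using () renaming (interchange to +-interchange)
  open CommSemigroupProperties *-commutativeSemigroup using (x∙yz≈y∙xz) renaming (interchange to *-interchange)
  open import Relation.Binary.Reasoning.Setoid setoid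

  Σ-cong : ∀ n {f g : ℕ → Carrier} → (∀ i → i ≤ n → f i ≈ g i) → Σ≤ n f ≈ Σ≤ n g
  Σ-cong zero    f≈g = f≈g 0 z≤n
  Σ-cong (suc n) f≈g =
    +-cong (Σ-cong n (λ i i≤n → f≈g i (ℕP.m≤n⇒m≤1+n i≤n))) (f≈g (suc n) ℕP.≤-refl)

  Σ-+ : ∀ n (f g : ℕ → Carrier) → Σ≤ n (λ i → f i + g i) ≈ Σ≤ n f + Σ≤ n g
  Σ-+ zero    f g = refl
  Σ-+ (suc n) f g = begin
    Σ≤ n (λ i → f i + g i) + (f (suc n) + g (suc n))
      ≈⟨ +-congʳ (Σ-+ n f g) ⟩
    (Σ≤ n f + Σ≤ n g) + (f (suc n) + g (suc n))
      ≈⟨ +-interchange (Σ≤ n f) (Σ≤ n g) (f (suc n)) (g (suc n)) ⟩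
    (Σ≤ n f + f (suc n)) + (Σ≤ n g + g (suc n)) ∎

  Σ-*ˡ : ∀ n x (f : ℕ → Carrier) → Σ≤ n (λ i → x * f i) ≈ x * Σ≤ n f
  Σ-*ˡ zero    x f = refl
  Σ-*ˡ (suc n) x f = trans (+-congʳ (Σ-*ˡ n x f)) (sym (distribˡ x (Σ≤ n f) (f (suc n))))

  Σ-*ʳ : ∀ n x (f : ℕ → Carrier) → Σ≤ n (λ i → f i * x) ≈ Σ≤ n f * x
  Σ-*ʳ zero    x f = refl
  Σ-*ʳ (suc n) x f = trans (+-congʳ (Σ-*ʳ n x f)) (sym (distribʳ x (Σ≤ n f) (f (suc n))))

  Σ-zero : ∀ n (f : ℕ → Carrier) → (∀ i → i ≤ n → f i ≈ 0#) → Σ≤ n f ≈ 0#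
  Σ-zero n f f≈0 = trans (Σ-cong n f≈0) (Σ-0# n)
    where
    Σ-0# : ∀ n → Σ≤ n (λ _ → 0#) ≈ 0#
    Σ-0# zero    = refl
    Σ-0# (suc n) = trans (+-congʳ (Σ-0# n)) (+-identityˡ 0#)

  Σ-head : ∀ n (f : ℕ → Carrier) → Σ≤ (suc n) f ≈ f 0 + Σ≤ n (λ i → f (suc i))
  Σ-head zero    f = refl
  Σ-head (suc n) f = trans (+-congʳ (Σ-head n f)) (+-assoc _ _ _)

  Σ-truncate : ∀ m n (f : ℕ → Carrier) → m ≤ n →
               (∀ i → m < i → i ≤ n → f i ≈ 0#) → Σ≤ n f ≈ Σ≤ m f
  Σ-truncate m n f m≤n vanish with ℕP.m≤n⇒m<n∨m≡n m≤n
  Σ-truncate m .m f _ vanish | inj₂ P.refl = refl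
  Σ-truncate m (suc n) f _ vanish | inj₁ (s≤s m≤n) = begin
    Σ≤ n f + f (suc n) ≈⟨ +-congˡ (vanish (suc n) (s≤s m≤n) ℕP.≤-refl) ⟩
    Σ≤ n f + 0#        ≈⟨ +-identityʳ _ ⟩
    Σ≤ n f             ≈⟨ Σ-truncate m n f m≤n (λ i m<i i≤n → vanish i m<i (ℕP.m≤n⇒m≤1+n i≤n)) ⟩
    Σ≤ m f             ∎

  Σ-swap : ∀ n m (f : ℕ → ℕ → Carrier) →
           Σ≤ n (λ i → Σ≤ m (λ j → f i j)) ≈ Σ≤ m (λ j → Σ≤ n (λ i → f i j))
  Σ-swap zero    m f = refl
  Σ-swap (suc n) m f =
    trans (+-congʳ (Σ-swap n m f)) (sym (Σ-+ m (λ j → Σ≤ n (λ i → f i j)) (f (suc n))))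

  -- The embeddings ℕ → F and ℤ → F are ring homomorphisms.  For ℕ this
  -- comes from the library, as ι n is the n-fold sum n × 1#.
  ι≈× : ∀ n → ι n ≈ n × 1#
  ι≈× zero    = refl
  ι≈× (suc n) = +-congˡ (ι≈× n)

  ι-+ : ∀ m n → ι (m ℕ.+ n) ≈ ι m + ι n
  ι-+ m n = begin
    ι (m ℕ.+ n)      ≈⟨ ι≈× (m ℕ.+ n) ⟩
    (m ℕ.+ n) × 1#   ≈⟨ ×-homo-+ 1# m n ⟩
    m × 1# + n × 1#  ≈⟨ sym (+-cong (ι≈× m) (ι≈× n)) ⟩
    ι m + ι n        ∎

  ι-* : ∀ m n → ι (m ℕ.* n) ≈ ι m * ι n
  ι-* m n = begin
    ι (m ℕ.* n)          ≈⟨ ι≈× (m ℕ.* n) ⟩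
    (m ℕ.* n) × 1#       ≈⟨ ×1-homo-* m n ⟩
    (m × 1#) * (n × 1#)  ≈⟨ sym (*-cong (ι≈× m) (ι≈× n)) ⟩
    ι m * ι n            ∎

  -- ιℤ on a difference of naturals; integer addition is defined through it.
  ιℤ-⊖ : ∀ m n → ιℤ (m ℤ.⊖ n) ≈ ι m - ι n
  ιℤ-⊖ zero    zero    = sym (-‿inverseʳ 0#)
  ιℤ-⊖ zero    (suc n) = sym (+-identityˡ _)
  ιℤ-⊖ (suc m) zero    = sym (trans (+-congˡ -0#≈0#) (+-identityʳ _))
  ιℤ-⊖ (suc m) (suc n) = begin
    ιℤ (suc m ℤ.⊖ suc n)         ≈⟨ reflexive (P.cong ιℤ (ℤP.[1+m]⊖[1+n]≡m⊖n m n)) ⟩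
    ιℤ (m ℤ.⊖ n)                 ≈⟨ ιℤ-⊖ m n ⟩
    ι m - ι n                    ≈⟨ sym (+-identityˡ _) ⟩
    0# + (ι m - ι n)             ≈⟨ +-congʳ (sym (-‿inverseʳ 1#)) ⟩
    (1# - 1#) + (ι m - ι n)      ≈⟨ +-interchange 1# (- 1#) (ι m) (- ι n) ⟩
    (1# + ι m) + (- 1# + - ι n)  ≈⟨ +-congˡ (-‿+-comm 1# (ι n)) ⟩
    (1# + ι m) - (1# + ι n)      ∎

  ιℤ-+ : ∀ x y → ιℤ (x ℤ.+ y) ≈ ιℤ x + ιℤ y
  ιℤ-+ -[1+ m ] -[1+ n ] = begin
    - (1# + (1# + ι (m ℕ.+ n)))   ≈⟨ -‿cong (+-congˡ (+-congˡ (ι-+ m n))) ⟩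
    - (1# + (1# + (ι m + ι n)))   ≈⟨ -‿cong (sym (+-assoc 1# 1# _)) ⟩
    - ((1# + 1#) + (ι m + ι n))   ≈⟨ -‿cong (+-interchange 1# 1# (ι m) (ι n)) ⟩
    - ((1# + ι m) + (1# + ι n))   ≈⟨ sym (-‿+-comm _ _) ⟩
    - (1# + ι m) + - (1# + ι n)   ∎
  ιℤ-+ -[1+ m ] (+ n)    = trans (ιℤ-⊖ n (suc m)) (+-comm _ _)
  ιℤ-+ (+ m)    -[1+ n ] = ιℤ-⊖ m (suc n)
  ιℤ-+ (+ m)    (+ n)    = ι-+ m n

  ιℤ-neg : ∀ x → ιℤ (ℤ.- x) ≈ - ιℤ x
  ιℤ-neg (+ zero)  = sym -0#≈0#
  ιℤ-neg (+ suc n) = refl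
  ιℤ-neg -[1+ n ]  = sym (-‿involutive _)

  -- Multiplicativity goes through the sign/absolute-value decomposition
  -- used to define integer multiplication.
  ιs : Sign → Carrier
  ιs Sign.+ = 1#
  ιs Sign.- = - 1#

  ιs-* : ∀ s t → ιs (s Sign.* t) ≈ ιs s * ιs t
  ιs-* Sign.+ t       = sym (*-identityˡ _)
  ιs-* Sign.- Sign.+  = sym (*-identityʳ _)
  ιs-* Sign.- Sign.-  = begin
    1#             ≈⟨ sym (-‿involutive 1#) ⟩
    - - 1#         ≈⟨ -‿cong (sym (-1*x≈-x 1#)) ⟩
    - (- 1# * 1#)  ≈⟨ -‿distribʳ-* (- 1#) 1# ⟩
    - 1# * - 1#    ∎

  ιℤ-◃ : ∀ s n → ιℤ (s ℤ.◃ n) ≈ ιs s * ι n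
  ιℤ-◃ s      zero    = sym (zeroʳ _)
  ιℤ-◃ Sign.+ (suc n) = sym (*-identityˡ _)
  ιℤ-◃ Sign.- (suc n) = sym (-1*x≈-x _)

  ιℤ-sign-abs : ∀ x → ιℤ x ≈ ιs (ℤ.sign x) * ι ℤ.∣ x ∣
  ιℤ-sign-abs (+ n)    = sym (*-identityˡ _)
  ιℤ-sign-abs -[1+ n ] = sym (-1*x≈-x _)

  ιℤ-* : ∀ x y → ιℤ (x ℤ.* y) ≈ ιℤ x * ιℤ y
  ιℤ-* x y = begin
    ιℤ (x ℤ.* y)
      ≈⟨ ιℤ-◃ (ℤ.sign x Sign.* ℤ.sign y) (ℤ.∣ x ∣ ℕ.* ℤ.∣ y ∣) ⟩
    ιs (ℤ.sign x Sign.* ℤ.sign y) * ι (ℤ.∣ x ∣ ℕ.* ℤ.∣ y ∣)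
      ≈⟨ *-cong (ιs-* (ℤ.sign x) (ℤ.sign y)) (ι-* ℤ.∣ x ∣ ℤ.∣ y ∣) ⟩
    (ιs (ℤ.sign x) * ιs (ℤ.sign y)) * (ι ℤ.∣ x ∣ * ι ℤ.∣ y ∣)
      ≈⟨ *-interchange _ _ _ _ ⟩
    (ιs (ℤ.sign x) * ι ℤ.∣ x ∣) * (ιs (ℤ.sign y) * ι ℤ.∣ y ∣)
      ≈⟨ sym (*-cong (ιℤ-sign-abs x) (ιℤ-sign-abs y)) ⟩
    ιℤ x * ιℤ y ∎

  ιS₁-rec : ∀ n l → ιℤ (S₁ (suc n) (suc l)) ≈ ιℤ (S₁ n l) - ι n * ιℤ (S₁ n (suc l))
  ιS₁-rec n l = begin
    ιℤ (S₁ n l ℤ.+ ℤ.- (+ n ℤ.* S₁ n (suc l)))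
      ≈⟨ ιℤ-+ (S₁ n l) (ℤ.- (+ n ℤ.* S₁ n (suc l))) ⟩
    ιℤ (S₁ n l) + ιℤ (ℤ.- (+ n ℤ.* S₁ n (suc l)))
      ≈⟨ +-congˡ (trans (ιℤ-neg (+ n ℤ.* S₁ n (suc l))) (-‿cong (ιℤ-* (+ n) (S₁ n (suc l))))) ⟩
    ιℤ (S₁ n l) - ι n * ιℤ (S₁ n (suc l)) ∎

  S₁-vanish : ∀ m l → m < l → S₁ m l ≡ + 0
  S₁-vanish zero    (suc l) _ = P.refl
  S₁-vanish (suc m) (suc l) (s≤s m<l)
    rewrite S₁-vanish m l m<l | S₁-vanish m (suc l) (ℕP.m≤n⇒m≤1+n m<l)
          | ℤP.*-zeroʳ (+ m) = P.refl

  ιS₁-vanish : ∀ m l → m < l → ιℤ (S₁ m l) ≈ 0#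
  ιS₁-vanish m l m<l = reflexive (P.cong ιℤ (S₁-vanish m l m<l))

  -- With ιℤ a ring homomorphism, the ring solver with integer coefficients
  -- is available for F; it normalises all remaining routine ring identities.
  ιℤ-homomorphism : CommutativeRing.rawRing ℤP.+-*-commutativeRing
                      -Raw-AlmostCommutative⟶ fromCommutativeRing ring
  ιℤ-homomorphism = record
    { ⟦_⟧ = ιℤ ; +-homo = ιℤ-+ ; *-homo = ιℤ-* ; -‿homo = ιℤ-neg
    ; 0-homo = refl ; 1-homo = +-identityʳ 1# }

  ιℤ-≟ : ∀ x y → Maybe.Maybe (ιℤ x ≈ ιℤ y)
  ιℤ-≟ x y = Maybe.map (λ x≡y → reflexive (P.cong ιℤ x≡y)) (dec⇒weaklyDec ℤ._≟_ x y)

  open RingSolver _ _ ιℤ-homomorphism ιℤ-≟ using (solve; _:=_; _:+_; _:*_; _:-_)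

  ^-cong : ∀ {u v} → u ≈ v → ∀ l → u ^ l ≈ v ^ l
  ^-cong u≈v zero    = refl
  ^-cong u≈v (suc l) = *-cong u≈v (^-cong u≈v l)

  1^m≈1 : ∀ m → 1# ^ m ≈ 1#
  1^m≈1 zero    = refl
  1^m≈1 (suc m) = trans (*-identityˡ _) (1^m≈1 m)

  ^-distrib-* : ∀ x y l → (x * y) ^ l ≈ x ^ l * y ^ l
  ^-distrib-* x y zero    = sym (*-identityˡ 1#)
  ^-distrib-* x y (suc l) = trans (*-congˡ (^-distrib-* x y l))
    (*-interchange x y (x ^ l) (y ^ l))

  neg-^ : ∀ x l → (- x) ^ l ≈ (- 1#) ^ l * x ^ l
  neg-^ x l = trans (^-cong (sym (-1*x≈-x x)) l) (^-distrib-* (- 1#) x l)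

  invertible-cancel : ∀ {u v X Y} → u * v ≈ 1# → v * X ≈ v * Y → X ≈ Y
  invertible-cancel {u} {v} {X} {Y} uv≈1 vX≈vY = begin
    X              ≈⟨ sym (trans (*-congʳ uv≈1) (*-identityˡ X)) ⟩
    (u * v) * X    ≈⟨ *-assoc u v X ⟩
    u * (v * X)    ≈⟨ *-congˡ vX≈vY ⟩
    u * (v * Y)    ≈⟨ sym (*-assoc u v Y) ⟩
    (u * v) * Y    ≈⟨ trans (*-congʳ uv≈1) (*-identityˡ Y) ⟩
    Y              ∎

  ι-invSuc : ∀ n → ι (suc n) * invSuc n ≈ 1#
  ι-invSuc n = inv-law _ (char0 n)

  invFact-fact : ∀ n → invFact n * fact n ≈ 1#
  invFact-fact zero    = *-identityˡ 1#
  invFact-fact (suc n) = begin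
    (invSuc n * invFact n) * (ι (suc n) * fact n)
      ≈⟨ solve 4 (λ A B C D → ((A :* B) :* (C :* D)) := ((C :* A) :* (B :* D))) refl
           (invSuc n) (invFact n) (ι (suc n)) (fact n) ⟩
    (ι (suc n) * invSuc n) * (invFact n * fact n) ≈⟨ *-cong (ι-invSuc n) (invFact-fact n) ⟩
    1# * 1#                                       ≈⟨ *-identityˡ 1# ⟩
    1#                                            ∎

  fact≈ι! : ∀ n → fact n ≈ ι (n !)
  fact≈ι! zero    = sym (+-identityʳ 1#)
  fact≈ι! (suc n) = trans (*-congˡ (fact≈ι! n)) (sym (ι-* (suc n) (n !)))

  fact-binomial : ∀ n r → r ≤ n → fact n * invFact (n ∸ r) ≈ ι (n C r) * fact r
  fact-binomial n r r≤n = begin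
    fact n * invFact (n ∸ r)
      ≈⟨ *-congʳ (trans (fact≈ι! n) (reflexive (P.cong ι (P.sym (choose-factorials r≤n))))) ⟩
    ι ((n C r) ℕ.* (r ! ℕ.* (n ∸ r) !)) * invFact (n ∸ r)
      ≈⟨ *-congʳ (trans (ι-* (n C r) _) (*-congˡ (ι-* (r !) ((n ∸ r) !)))) ⟩
    (ι (n C r) * (ι (r !) * ι ((n ∸ r) !))) * invFact (n ∸ r)
      ≈⟨ *-congʳ (*-congˡ (*-cong (sym (fact≈ι! r)) (sym (fact≈ι! (n ∸ r))))) ⟩
    (ι (n C r) * (fact r * fact (n ∸ r))) * invFact (n ∸ r)
      ≈⟨ solve 4 (λ A B C D → ((A :* (B :* C)) :* D) := ((A :* B) :* (D :* C))) refl
           (ι (n C r)) (fact r) (fact (n ∸ r)) (invFact (n ∸ r)) ⟩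
    (ι (n C r) * fact r) * (invFact (n ∸ r) * fact (n ∸ r))
      ≈⟨ trans (*-congˡ (invFact-fact (n ∸ r))) (*-identityʳ _) ⟩
    ι (n C r) * fact r ∎

  ⊛-cong : ∀ {f f′ g g′ : Series} → (∀ i → f i ≈ f′ i) → (∀ i → g i ≈ g′ i) →
           ∀ n → (f ⊛ g) n ≈ (f′ ⊛ g′) n
  ⊛-cong f≈f′ g≈g′ n = Σ-cong n (λ i _ → *-cong (f≈f′ i) (g≈g′ (n ∸ i)))

  ⊛-+ˡ : ∀ (f g h : Series) n → ((λ i → f i + g i) ⊛ h) n ≈ (f ⊛ h) n + (g ⊛ h) n
  ⊛-+ˡ f g h n = trans (Σ-cong n (λ i _ → distribʳ (h (n ∸ i)) (f i) (g i))) (Σ-+ n _ _)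

  ⊛-+ʳ : ∀ (f g h : Series) n → (f ⊛ (λ i → g i + h i)) n ≈ (f ⊛ g) n + (f ⊛ h) n
  ⊛-+ʳ f g h n = trans (Σ-cong n (λ i _ → distribˡ (f i) (g (n ∸ i)) (h (n ∸ i)))) (Σ-+ n _ _)

  ⊛-*ˡ : ∀ x (f g : Series) n → ((λ i → x * f i) ⊛ g) n ≈ x * (f ⊛ g) n
  ⊛-*ˡ x f g n = trans (Σ-cong n (λ i _ → *-assoc x (f i) (g (n ∸ i)))) (Σ-*ˡ n x _)

  ⊛-*ʳ : ∀ x (f g : Series) n → (f ⊛ (λ i → x * g i)) n ≈ x * (f ⊛ g) n
  ⊛-*ʳ x f g n = trans (Σ-cong n (λ i _ → x∙yz≈y∙xz (f i) x (g (n ∸ i)))) (Σ-*ˡ n x _)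

  -- pow h 0 is the unit series 1, whatever h is; it is neutral for ⊛.
  unit-⊛ : ∀ (h f : Series) n → (pow h 0 ⊛ f) n ≈ f n
  unit-⊛ h f zero    = *-identityˡ _
  unit-⊛ h f (suc n) = begin
    Σ≤ (suc n) (λ i → pow h 0 i * f (suc n ∸ i))  ≈⟨ Σ-head n _ ⟩
    1# * f (suc n) + Σ≤ n (λ i → 0# * f (n ∸ i))  ≈⟨ +-cong (*-identityˡ _) (Σ-zero n _ (λ i _ → zeroˡ _)) ⟩
    f (suc n) + 0#                                 ≈⟨ +-identityʳ _ ⟩
    f (suc n)                                      ∎

  -- Beyond the diagonal i = n the unit series vanishes.
  ⊛-unit : ∀ (h f : Series) n → (f ⊛ pow h 0) n ≈ f n
  ⊛-unit h f zero    = *-identityʳ _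
  ⊛-unit h f (suc n) = begin
    Σ≤ n (λ i → f i * pow h 0 (suc n ∸ i)) + f (suc n) * pow h 0 (n ∸ n)
      ≈⟨ +-cong (Σ-zero n _ beyond-diagonal) (*-congˡ (reflexive (P.cong (pow h 0) (ℕP.n∸n≡0 n)))) ⟩
    0# + f (suc n) * 1#  ≈⟨ trans (+-identityˡ _) (*-identityʳ _) ⟩
    f (suc n)            ∎
    where
    beyond-diagonal : ∀ i → i ≤ n → f i * pow h 0 (suc n ∸ i) ≈ 0#
    beyond-diagonal i i≤n rewrite ℕP.+-∸-assoc 1 i≤n = zeroʳ _

  pow-scale : ∀ s (f : Series) m n → pow (scale s f) m n ≈ s ^ m * pow f m n
  pow-scale s f zero    zero    = sym (*-identityˡ _)
  pow-scale s f zero    (suc n) = sym (*-identityˡ _)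
  pow-scale s f (suc m) n = begin
    Σ≤ n (λ i → (s * f i) * pow (scale s f) m (n ∸ i))
      ≈⟨ Σ-cong n (λ i _ → *-congˡ (pow-scale s f m (n ∸ i))) ⟩
    Σ≤ n (λ i → (s * f i) * (s ^ m * pow f m (n ∸ i)))
      ≈⟨ Σ-cong n (λ i _ → *-interchange s (f i) (s ^ m) (pow f m (n ∸ i))) ⟩
    Σ≤ n (λ i → (s * s ^ m) * (f i * pow f m (n ∸ i)))
      ≈⟨ Σ-*ˡ n _ _ ⟩
    (s * s ^ m) * Σ≤ n (λ i → f i * pow f m (n ∸ i)) ∎

  -- ∂ = d/dt and E = t d/dt on coefficient sequences; note that
  -- ∂ f n = E f (n + 1) definitionally.
  ∂ : Series → Series
  ∂ f n = ι (suc n) * f (suc n)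

  E : Series → Series
  E f n = ι n * f n

  -- Leibniz rule for E: split the weight n = i + (n ∸ i) in each summand.
  E-Leibniz : ∀ (f g : Series) n → E (f ⊛ g) n ≈ (E f ⊛ g) n + (f ⊛ E g) n
  E-Leibniz f g n = begin
    ι n * Σ≤ n term
      ≈⟨ sym (Σ-*ˡ n _ term) ⟩
    Σ≤ n (λ i → ι n * term i)
      ≈⟨ Σ-cong n split-weight ⟩
    Σ≤ n (λ i → ι i * term i + ι (n ∸ i) * term i)
      ≈⟨ Σ-+ n _ _ ⟩
    Σ≤ n (λ i → ι i * term i) + Σ≤ n (λ i → ι (n ∸ i) * term i)
      ≈⟨ +-cong (Σ-cong n (λ i _ → sym (*-assoc _ _ _)))
                (Σ-cong n (λ i _ → x∙yz≈y∙xz _ _ _)) ⟩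
    (E f ⊛ g) n + (f ⊛ E g) n ∎
    where
    term : ℕ → Carrier
    term i = f i * g (n ∸ i)
    split-weight : ∀ i → i ≤ n → ι n * term i ≈ ι i * term i + ι (n ∸ i) * term i
    split-weight i i≤n = begin
      ι n * term i                       ≈⟨ *-congʳ (reflexive (P.cong ι (P.sym (ℕP.m+[n∸m]≡n i≤n)))) ⟩
      ι (i ℕ.+ (n ∸ i)) * term i         ≈⟨ *-congʳ (ι-+ i (n ∸ i)) ⟩
      (ι i + ι (n ∸ i)) * term i         ≈⟨ distribʳ (term i) _ _ ⟩
      ι i * term i + ι (n ∸ i) * term i  ∎

  -- Shifting E into ∂: the boundary summand carries the weight ι 0 = 0.
  E-shiftˡ : ∀ (f g : Series) n → (E f ⊛ g) (suc n) ≈ (∂ f ⊛ g) n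
  E-shiftˡ f g n = begin
    (E f ⊛ g) (suc n)                     ≈⟨ Σ-head n _ ⟩
    (0# * f 0) * g (suc n) + (∂ f ⊛ g) n  ≈⟨ +-congʳ (trans (*-congʳ (zeroˡ _)) (zeroˡ _)) ⟩
    0# + (∂ f ⊛ g) n                      ≈⟨ +-identityˡ _ ⟩
    (∂ f ⊛ g) n                           ∎

  E-shiftʳ : ∀ (f g : Series) n → (f ⊛ E g) (suc n) ≈ (f ⊛ ∂ g) n
  E-shiftʳ f g n = begin
    Σ≤ n (λ i → f i * E g (suc n ∸ i)) + f (suc n) * E g (n ∸ n)
      ≈⟨ +-congˡ (*-congˡ (reflexive (P.cong (E g) (ℕP.n∸n≡0 n)))) ⟩
    Σ≤ n (λ i → f i * E g (suc n ∸ i)) + f (suc n) * (0# * g 0)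
      ≈⟨ +-congˡ (trans (*-congˡ (zeroˡ _)) (zeroʳ _)) ⟩
    Σ≤ n (λ i → f i * E g (suc n ∸ i)) + 0#
      ≈⟨ +-identityʳ _ ⟩
    Σ≤ n (λ i → f i * E g (suc n ∸ i))
      ≈⟨ Σ-cong n (λ i i≤n → reflexive (P.cong (λ j → f i * E g j) (ℕP.+-∸-assoc 1 i≤n))) ⟩
    (f ⊛ ∂ g) n ∎

  ∂-Leibniz : ∀ (f g : Series) n → ∂ (f ⊛ g) n ≈ (∂ f ⊛ g) n + (f ⊛ ∂ g) n
  ∂-Leibniz f g n = trans (E-Leibniz f g (suc n)) (+-cong (E-shiftˡ f g n) (E-shiftʳ f g n))

  -- Powers of L = log(1 + t/a) and their closed form (★)

  module _ (a : Carrier) (a≢0 : ¬ (a ≈ 0#)) where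
    open WithA a a≢0

    a*a⁻¹≈1 : a * a⁻¹ ≈ 1#
    a*a⁻¹≈1 = inv-law a a≢0

    θ : Series → Series
    θ f n = a * ∂ f n + E f n

    θ-Leibniz : ∀ (f g : Series) n → θ (f ⊛ g) n ≈ (θ f ⊛ g) n + (f ⊛ θ g) n
    θ-Leibniz f g n = begin
      a * ∂ (f ⊛ g) n + E (f ⊛ g) n
        ≈⟨ +-cong (*-congˡ (∂-Leibniz f g n)) (E-Leibniz f g n) ⟩
      a * ((∂ f ⊛ g) n + (f ⊛ ∂ g) n) + ((E f ⊛ g) n + (f ⊛ E g) n)
        ≈⟨ solve 5 (λ A X₁ X₂ Y₁ Y₂ → ((A :* (X₁ :+ X₂)) :+ (Y₁ :+ Y₂))
                                   := (((A :* X₁) :+ Y₁) :+ ((A :* X₂) :+ Y₂))) refl a _ _ _ _ ⟩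
      (a * (∂ f ⊛ g) n + (E f ⊛ g) n) + (a * (f ⊛ ∂ g) n + (f ⊛ E g) n)
        ≈⟨ sym (+-cong (trans (⊛-+ˡ (λ i → a * ∂ f i) (E f) g n) (+-congʳ (⊛-*ˡ a (∂ f) g n)))
                       (trans (⊛-+ʳ f (λ i → a * ∂ g i) (E g) n) (+-congʳ (⊛-*ʳ a f (∂ g) n)))) ⟩
      (θ f ⊛ g) n + (f ⊛ θ g) n ∎

    θ-unit : ∀ (f : Series) n → θ (pow f 0) n ≈ 0#
    θ-unit f zero    = trans (+-cong (trans (*-congˡ (zeroʳ _)) (zeroʳ a)) (zeroˡ _)) (+-identityʳ 0#)
    θ-unit f (suc n) = trans (+-cong (trans (*-congˡ (zeroʳ _)) (zeroʳ a)) (zeroʳ _)) (+-identityʳ 0#)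

    -- (a + t) d/dt log(1 + t/a) = 1, on coefficients: a ∂L_n = (-1)^n a^{-n}
    -- cancels E L_n = (-1)^{n-1} a^{-n} for n ≥ 1.
    a∂L : ∀ n → a * ∂ logA n ≈ (- 1#) ^ n * a⁻¹ ^ n
    a∂L n = begin
      a * (ι (suc n) * (((- 1#) ^ n * invSuc n) * (a⁻¹ * a⁻¹ ^ n)))
        ≈⟨ solve 6 (λ A A′ I J S P → (A :* (I :* ((S :* J) :* (A′ :* P))))
                                   := ((A :* A′) :* ((I :* J) :* (S :* P))))
                 refl a a⁻¹ (ι (suc n)) (invSuc n) ((- 1#) ^ n) (a⁻¹ ^ n) ⟩
      (a * a⁻¹) * ((ι (suc n) * invSuc n) * ((- 1#) ^ n * a⁻¹ ^ n))
        ≈⟨ *-cong a*a⁻¹≈1 (*-congʳ (ι-invSuc n)) ⟩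
      1# * (1# * ((- 1#) ^ n * a⁻¹ ^ n))
        ≈⟨ trans (*-identityˡ _) (*-identityˡ _) ⟩
      (- 1#) ^ n * a⁻¹ ^ n ∎

    θ-log : ∀ n → θ logA n ≈ pow logA 0 n
    θ-log zero = begin
      a * ∂ logA 0 + 0# * 0#  ≈⟨ +-cong (a∂L 0) (zeroˡ 0#) ⟩
      1# * 1# + 0#            ≈⟨ trans (+-identityʳ _) (*-identityˡ 1#) ⟩
      1#                      ∎
    θ-log (suc m) = begin
      a * ∂ logA (suc m) + ι (suc m) * (((- 1#) ^ m * invSuc m) * a⁻¹ ^ suc m)
        ≈⟨ +-cong (a∂L (suc m))
                  (solve 4 (λ I J S P → (I :* ((S :* J) :* P)) := ((I :* J) :* (S :* P)))
                         refl (ι (suc m)) (invSuc m) ((- 1#) ^ m) (a⁻¹ ^ suc m)) ⟩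
      (- 1# * (- 1#) ^ m) * a⁻¹ ^ suc m + (ι (suc m) * invSuc m) * ((- 1#) ^ m * a⁻¹ ^ suc m)
        ≈⟨ +-cong (trans (*-assoc _ _ _) (-1*x≈-x _)) (trans (*-congʳ (ι-invSuc m)) (*-identityˡ _)) ⟩
      - ((- 1#) ^ m * a⁻¹ ^ suc m) + (- 1#) ^ m * a⁻¹ ^ suc m
        ≈⟨ -‿inverseˡ _ ⟩
      0# ∎

    -- By the Leibniz rule θ(L^{m+1}) = θL · L^m + L · θ(L^m) = L^m + L · θ(L^m).
    θ-pow-step : ∀ m n → θ (pow logA (suc m)) n ≈ pow logA m n + (logA ⊛ θ (pow logA m)) n
    θ-pow-step m n = begin
      θ (logA ⊛ pow logA m) n
        ≈⟨ θ-Leibniz logA (pow logA m) n ⟩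
      (θ logA ⊛ pow logA m) n + (logA ⊛ θ (pow logA m)) n
        ≈⟨ +-congʳ (trans (⊛-cong {g = pow logA m} θ-log (λ _ → refl) n) (unit-⊛ logA (pow logA m) n)) ⟩
      pow logA m n + (logA ⊛ θ (pow logA m)) n ∎

    θ-pow : ∀ m n → θ (pow logA (suc m)) n ≈ ι (suc m) * pow logA m n
    θ-pow zero n = begin
      θ (pow logA 1) n
        ≈⟨ θ-pow-step 0 n ⟩
      pow logA 0 n + (logA ⊛ θ (pow logA 0)) n
        ≈⟨ +-congˡ (Σ-zero n _ (λ i _ → trans (*-congˡ (θ-unit logA (n ∸ i))) (zeroʳ _))) ⟩
      pow logA 0 n + 0#
        ≈⟨ +-identityʳ _ ⟩
      pow logA 0 n
        ≈⟨ sym (trans (*-congʳ (+-identityʳ 1#)) (*-identityˡ _)) ⟩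
      ι 1 * pow logA 0 n ∎
    θ-pow (suc m) n = begin
      θ (pow logA (suc (suc m))) n
        ≈⟨ θ-pow-step (suc m) n ⟩
      pow logA (suc m) n + (logA ⊛ θ (pow logA (suc m))) n
        ≈⟨ +-congˡ (trans (⊛-cong {f = logA} (λ _ → refl) (θ-pow m) n) (⊛-*ʳ (ι (suc m)) logA (pow logA m) n)) ⟩
      pow logA (suc m) n + ι (suc m) * pow logA (suc m) n
        ≈⟨ +-congʳ (sym (*-identityˡ _)) ⟩
      1# * pow logA (suc m) n + ι (suc m) * pow logA (suc m) n
        ≈⟨ sym (distribʳ _ _ _) ⟩
      ι (suc (suc m)) * pow logA (suc m) n ∎

    logPowCoeff : ℕ → ℕ → Carrier
    logPowCoeff m n = fact m * ιℤ (S₁ n m) * a⁻¹ ^ n * invFact n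

    -- θ(L^{m+1}) = (m+1) L^m, read on the coefficient of t^n, holds for the
    -- closed form as well; this is the Stirling recurrence.
    logPowCoeff-rec : ∀ m n →
      a * (ι (suc n) * logPowCoeff (suc m) (suc n)) + ι n * logPowCoeff (suc m) n
        ≈ ι (suc m) * logPowCoeff m n
    logPowCoeff-rec m n = begin
      a * (ι (suc n) * logPowCoeff (suc m) (suc n)) + ι n * logPowCoeff (suc m) n
        ≈⟨ +-congʳ leading ⟩
      K * s₁ + ι n * logPowCoeff (suc m) n
        ≈⟨ +-congʳ (*-congˡ (ιS₁-rec n m)) ⟩
      K * (s₀ - ι n * s₂) + ι n * logPowCoeff (suc m) n
        ≈⟨ solve 7 (λ M Fm P Q S₀ S₂ N →
                      ((((M :* Fm) :* P) :* Q) :* (S₀ :- (N :* S₂)) :+ (N :* ((((M :* Fm) :* S₂) :* P) :* Q)))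
                      := (M :* (((Fm :* S₀) :* P) :* Q)))
                 refl (ι (suc m)) (fact m) (a⁻¹ ^ n) (invFact n) s₀ s₂ (ι n) ⟩
      ι (suc m) * logPowCoeff m n ∎
      where
      s₀ s₁ s₂ K : Carrier
      s₀ = ιℤ (S₁ n m)
      s₁ = ιℤ (S₁ (suc n) (suc m))
      s₂ = ιℤ (S₁ n (suc m))
      K = ((ι (suc m) * fact m) * a⁻¹ ^ n) * invFact n
      leading : a * (ι (suc n) * logPowCoeff (suc m) (suc n)) ≈ K * s₁
      leading = begin
        a * (ι (suc n) * logPowCoeff (suc m) (suc n))
          ≈⟨ solve 9 (λ A A′ I J M Fm S₁ P Q →
                        (A :* (I :* ((((M :* Fm) :* S₁) :* (A′ :* P)) :* (J :* Q))))
                        := ((A :* A′) :* ((I :* J) :* ((((M :* Fm) :* P) :* Q) :* S₁))))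
                   refl a a⁻¹ (ι (suc n)) (invSuc n) (ι (suc m)) (fact m) s₁ (a⁻¹ ^ n) (invFact n) ⟩
        (a * a⁻¹) * ((ι (suc n) * invSuc n) * (K * s₁))
          ≈⟨ *-cong a*a⁻¹≈1 (*-congʳ (ι-invSuc n)) ⟩
        1# * (1# * (K * s₁))
          ≈⟨ trans (*-identityˡ _) (*-identityˡ _) ⟩
        K * s₁ ∎

    -- The recurrence determines X = c_{m+1}(n+1) from c_{m+1}(n) and c_m(n),
    -- because a and n + 1 are invertible.
    recurrence-determines : ∀ n {X X′ Y Y′ Z Z′} →
      a * (ι (suc n) * X) + Y ≈ Z → a * (ι (suc n) * X′) + Y′ ≈ Z′ →
      Y ≈ Y′ → Z ≈ Z′ → X ≈ X′
    recurrence-determines n {X} {X′} {Y} {Y′} eq eq′ Y≈Y′ Z≈Z′ =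
      invertible-cancel invSuc*ι≈1 (invertible-cancel a⁻¹*a≈1 leading≈)
      where
      a⁻¹*a≈1 : a⁻¹ * a ≈ 1#
      a⁻¹*a≈1 = trans (*-comm a⁻¹ a) a*a⁻¹≈1
      invSuc*ι≈1 : invSuc n * ι (suc n) ≈ 1#
      invSuc*ι≈1 = trans (*-comm _ _) (ι-invSuc n)
      leading≈ : a * (ι (suc n) * X) ≈ a * (ι (suc n) * X′)
      leading≈ = +-cancelʳ Y _ _ (trans eq (trans Z≈Z′ (trans (sym eq′) (+-congˡ (sym Y≈Y′)))))

    S₁-factor≈0 : ∀ {A s P Q} → A * s ≈ 0# → A * s * P * Q ≈ 0#
    S₁-factor≈0 As≈0 = trans (*-congʳ (trans (*-congʳ As≈0) (zeroˡ _))) (zeroˡ _)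

    -- (★) [t^n] L^m = m! S₁(n,m) a^{-n} / n!.  When m = 0 or n = 0 both sides
    -- are 1 or 0; otherwise use the recurrence satisfied by both sides.
    pow-log : ∀ m n → pow logA m n ≈ logPowCoeff m n
    pow-log zero    zero    =
      sym (trans (*-identityʳ _) (trans (*-identityʳ _) (trans (*-identityˡ _) (+-identityʳ 1#))))
    pow-log zero    (suc n) = sym (S₁-factor≈0 (zeroʳ _))
    pow-log (suc m) zero    = trans (zeroˡ _) (sym (S₁-factor≈0 (zeroʳ _)))
    pow-log (suc m) (suc n) =
      recurrence-determines n (θ-pow m n) (logPowCoeff-rec m n)
        (*-congˡ (pow-log (suc m) n)) (*-congˡ (pow-log m n))

    -- The coefficients of (1 + t/a)^{-x} = Σ_m (-x)^m L^m / m!, by (★).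
    powA-coeff : ∀ x n → powA x n ≈ (a⁻¹ ^ n * invFact n) * Σ≤ n (λ l → ιℤ (S₁ n l) * (- x) ^ l)
    powA-coeff x n = begin
      Σ≤ n (λ m → (1# ^ m * invFact m) * pow (scale (- x) logA) m n)
        ≈⟨ Σ-cong n (λ m _ → *-cong (trans (*-congʳ (1^m≈1 m)) (*-identityˡ _))
                                    (trans (pow-scale (- x) logA m n) (*-congˡ (pow-log m n)))) ⟩
      Σ≤ n (λ m → invFact m * ((- x) ^ m * logPowCoeff m n))
        ≈⟨ Σ-cong n (λ m _ → solve 6 (λ I Fm S P Q Y →
                                (I :* (Y :* (((Fm :* S) :* P) :* Q)))
                                := ((I :* Fm) :* ((P :* Q) :* (S :* Y))))
                               refl (invFact m) (fact m) (ιℤ (S₁ n m)) (a⁻¹ ^ n) (invFact n) ((- x) ^ m)) ⟩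
      Σ≤ n (λ m → (invFact m * fact m) * ((a⁻¹ ^ n * invFact n) * (ιℤ (S₁ n m) * (- x) ^ m)))
        ≈⟨ Σ-cong n (λ m _ → trans (*-congʳ (invFact-fact m)) (*-identityˡ _)) ⟩
      Σ≤ n (λ m → (a⁻¹ ^ n * invFact n) * (ιℤ (S₁ n m) * (- x) ^ m))
        ≈⟨ Σ-*ˡ n _ _ ⟩
      (a⁻¹ ^ n * invFact n) * Σ≤ n (λ l → ιℤ (S₁ n l) * (- x) ^ l) ∎

    -- (1 + t/a)^0 = 1: for n > 0 every summand vanishes, as S₁(n,0) = 0 and
    -- 0^l = 0 for l > 0.
    powA-zero : ∀ n → powA 0# n ≈ pow logA 0 n
    powA-zero zero = begin
      powA 0# 0                          ≈⟨ powA-coeff 0# 0 ⟩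
      (1# * 1#) * ((1# + 0#) * 1#)       ≈⟨ *-cong (*-identityˡ 1#) (trans (*-identityʳ _) (+-identityʳ 1#)) ⟩
      1# * 1#                            ≈⟨ *-identityˡ 1# ⟩
      1#                                 ∎
    powA-zero (suc n) = trans (powA-coeff 0# (suc n)) (trans (*-congˡ sum≈0) (zeroʳ _))
      where
      higher≈0 : ∀ l → l ≤ n → ιℤ (S₁ (suc n) (suc l)) * (- 0#) ^ suc l ≈ 0#
      higher≈0 l _ = trans (*-congˡ (trans (*-congʳ -0#≈0#) (zeroˡ _))) (zeroʳ _)
      sum≈0 : Σ≤ (suc n) (λ l → ιℤ (S₁ (suc n) l) * (- 0#) ^ l) ≈ 0#
      sum≈0 = trans (Σ-head n _) (trans (+-cong (zeroˡ _) (Σ-zero n _ higher≈0)) (+-identityˡ 0#))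

    H : ℤ → Series
    H k = expS (- 1#) ⊛ compose (Lif k) logA

    -- PC_r(0) = r! H_r, since (1 + t/a)^0 = 1.
    PC-at-zero : ∀ k r → PC k r 0# ≈ fact r * H k r
    PC-at-zero k r = *-congˡ (trans (⊛-cong {f = H k} (λ _ → refl) powA-zero r) (⊛-unit logA (H k) r))

    module _ (k : ℤ) (n : ℕ) (x : Carrier) where

      -- The contribution of H_r and of x^l to PC_n(x); both sides of the
      -- theorem are rearranged into the double sum of these terms.
      expansionTerm : ℕ → ℕ → Carrier
      expansionTerm r l =
        (fact n * (H k r * (a⁻¹ ^ (n ∸ r) * invFact (n ∸ r)))) * (ιℤ (S₁ (n ∸ r) l) * (- x) ^ l)

      statedCoeff : ℕ → ℕ → Carrier
      statedCoeff l r = ((- 1#) ^ l) * (a⁻¹ ^ (n ∸ r)) * ι (n C r) * ιℤ (S₁ (n ∸ r) l) * PC k r 0#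

      -- PC_n(x) = n! Σ_r H_r [t^{n-r}](1 + t/a)^{-x}, expanded by powA-coeff;
      -- the inner range l ≤ n ∸ r extends to l ≤ n as S₁(n ∸ r, l) = 0 beyond it.
      PC-expansion : PC k n x ≈ Σ≤ n (λ l → Σ≤ n (λ r → expansionTerm r l))
      PC-expansion = begin
        fact n * Σ≤ n (λ r → H k r * powA x (n ∸ r))
          ≈⟨ *-congˡ (Σ-cong n (λ r _ → *-congˡ (powA-coeff x (n ∸ r)))) ⟩
        fact n * Σ≤ n (λ r → H k r * ((a⁻¹ ^ (n ∸ r) * invFact (n ∸ r)) * inner r))
          ≈⟨ sym (Σ-*ˡ n _ _) ⟩
        Σ≤ n (λ r → fact n * (H k r * ((a⁻¹ ^ (n ∸ r) * invFact (n ∸ r)) * inner r)))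
          ≈⟨ Σ-cong n (λ r _ → trans (solve 4 (λ N h p S → (N :* (h :* (p :* S))) := ((N :* (h :* p)) :* S))
                                              refl _ _ _ _)
                                     (sym (Σ-*ˡ (n ∸ r) _ _))) ⟩
        Σ≤ n (λ r → Σ≤ (n ∸ r) (expansionTerm r))
          ≈⟨ Σ-cong n (λ r _ → sym (Σ-truncate (n ∸ r) n (expansionTerm r) (ℕP.m∸n≤m n r)
                                      (λ l n∸r<l _ → beyond r l n∸r<l))) ⟩
        Σ≤ n (λ r → Σ≤ n (expansionTerm r))
          ≈⟨ Σ-swap n n expansionTerm ⟩
        Σ≤ n (λ l → Σ≤ n (λ r → expansionTerm r l)) ∎
        where
        inner : ℕ → Carrier
        inner r = Σ≤ (n ∸ r) (λ l → ιℤ (S₁ (n ∸ r) l) * (- x) ^ l)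
        beyond : ∀ r l → n ∸ r < l → expansionTerm r l ≈ 0#
        beyond r l n∸r<l = trans (*-congˡ (trans (*-congʳ (ιS₁-vanish (n ∸ r) l n∸r<l)) (zeroˡ _))) (zeroʳ _)

      -- Each stated summand is an expansion term: PC_r(0) = r! H_r,
      -- C(n,r) r! = n!/(n ∸ r)! and (-1)^l x^l = (-x)^l.
      statedCoeff≈expansionTerm : ∀ l r → r ≤ n → statedCoeff l r * x ^ l ≈ expansionTerm r l
      statedCoeff≈expansionTerm l r r≤n = begin
        statedCoeff l r * x ^ l
          ≈⟨ *-congʳ (*-congˡ (PC-at-zero k r)) ⟩
        ((((- 1#) ^ l * a⁻¹ ^ (n ∸ r)) * ι (n C r)) * ιℤ (S₁ (n ∸ r) l)) * (fact r * H k r) * x ^ l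
          ≈⟨ solve 7 (λ Sg P B S Fr h Xl → (((((Sg :* P) :* B) :* S) :* (Fr :* h)) :* Xl)
                                          := ((B :* Fr) :* ((h :* P) :* (S :* (Sg :* Xl)))))
                   refl _ _ _ _ _ _ _ ⟩
        (ι (n C r) * fact r) * ((H k r * a⁻¹ ^ (n ∸ r)) * (ιℤ (S₁ (n ∸ r) l) * ((- 1#) ^ l * x ^ l)))
          ≈⟨ *-cong (sym (fact-binomial n r r≤n)) (*-congˡ (*-congˡ (sym (neg-^ x l)))) ⟩
        (fact n * invFact (n ∸ r)) * ((H k r * a⁻¹ ^ (n ∸ r)) * (ιℤ (S₁ (n ∸ r) l) * (- x) ^ l))
          ≈⟨ solve 6 (λ N Q h P S Y → ((N :* Q) :* ((h :* P) :* (S :* Y)))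
                                     := ((N :* (h :* (P :* Q))) :* (S :* Y)))
                   refl _ _ _ _ _ _ ⟩
        expansionTerm r l ∎

      -- The right-hand side of the theorem is the same double sum: the range
      -- r ≤ n ∸ l extends to r ≤ n because S₁(n ∸ r, l) = 0 for r > n ∸ l.
      stated-expansion : Σ≤ n (λ l → Σ≤ (n ∸ l) (statedCoeff l) * x ^ l)
                           ≈ Σ≤ n (λ l → Σ≤ n (λ r → expansionTerm r l))
      stated-expansion = Σ-cong n (λ l _ → begin
        Σ≤ (n ∸ l) (statedCoeff l) * x ^ l
          ≈⟨ sym (Σ-*ʳ (n ∸ l) _ _) ⟩
        Σ≤ (n ∸ l) (λ r → statedCoeff l r * x ^ l)
          ≈⟨ sym (Σ-truncate (n ∸ l) n _ (ℕP.m∸n≤m n l) (λ r n∸l<r r≤n → beyond l r r≤n n∸l<r)) ⟩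
        Σ≤ n (λ r → statedCoeff l r * x ^ l)
          ≈⟨ Σ-cong n (statedCoeff≈expansionTerm l) ⟩
        Σ≤ n (λ r → expansionTerm r l) ∎)
        where
        beyond : ∀ l r → r ≤ n → n ∸ l < r → statedCoeff l r * x ^ l ≈ 0#
        beyond l r r≤n n∸l<r =
          trans (*-congʳ (trans (*-congʳ (trans (*-congˡ (ιS₁-vanish (n ∸ r) l (∸-swap-< n l r r≤n n∸l<r)))
                                                (zeroʳ _)))
                                (zeroˡ _)))
                (zeroˡ _)

theorem4 : {c ℓ : Level} (F : CharZeroField c ℓ) →
    let open CharZeroField F in
    let open FieldOps F in
    (n : ℕ) (k : ℤ) (a : Carrier) (a≢0 : ¬ (a ≈ 0#)) (x : Carrier) →
    let open WithA a a≢0 in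
    PC k n x ≈ Σ≤ n (λ l →
      Σ≤ (n ∸ l) (λ r →
        ((- 1#) ^ l) * (a⁻¹ ^ (n ∸ r)) * ι (n C r) * ιℤ (S₁ (n ∸ r) l) * PC k r 0#)
      * (x ^ l))
theorem4 F n k a a≢0 x =
  trans (PC-expansion F a a≢0 k n x) (sym (stated-expansion F a a≢0 k n x))
  where open CharZeroField F using (trans; sym)
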